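{- Let $R$ be a commutative ring, $V$ a free $R$-module of rank $n$, $M=\mathrm{End}_R(V)$, $G=\mathrm{Aut}_R(V)$. Let $\tau\in M$, $g\in G$, and let $\mathcal F$ be a decorated flag. Suppose that $\tau$ and $\mathrm{Ad}(g)\tau=g\tau g^{ -1}$ are both subcyclic with respect to $\mathcal F$. Then $g\in N_{\mathcal F}G_\tau$.
   Context: A decorated flag is a flag of submodules $V_1\subset\dots\subset V_n=V$ together with a basis element $\bar e_j$ of $V_j/V_{j-1}$ for each $j$; equivalently it is given by an ordered basis $(e_1,\dots,e_n)$ of $V$ via $V_j=\langle e_1,\dots,e_j\rangle$, $\bar e_j=$ image of $e_j$, two ordered bases giving the same decorated flag iff $e'_j-e_j\in\langle e_1,\dots,e_{j-1}\rangle$ for all $j$. $N_{\mathcal F}\le G$ is the stabilizer of $\mathcal F$ (automorphisms that are upper-triangular unipotent in a basis giving $\mathcal F$). $\tau$ is subcyclic with respect to $\mathcal F$ if for some (equivalently any) basis $(e_1,\dots,e_n)$ giving rise to $\mathcal F$, $\tau e_j-e_{j+1}\in\langle e_1,\dots,e_j\rangle$ for all $1\le j\le n-1$. $G_\tau$ is the centralizer of $\tau$ in $G$. -}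

module Defs where

open import Level using (_⊔_)
open import Data.Nat using (ℕ; zero; suc; _≤_)
open import Data.Fin using (Fin; toℕ)
import Data.Fin as F
open import Data.Product using (Σ; ∃; _×_; _,_)
open import Algebra.Bundles using (CommutativeRing)
open import Relation.Nullary using (yes; no)
open import Relation.Binary.PropositionalEquality using (_≡_)

-- Throughout, V is the free R-module of rank n, identified (via a fixed
-- basis) with R^n = (Fin n → R); M = End_R(V) is then the set of n×n
-- matrices and G = Aut_R(V) the invertible ones.
module Lin {c ℓ} (R : CommutativeRing c ℓ) where
  open CommutativeRing R

  Vec : ℕ → Set c
  Vec n = Fin n → Carrier

  Mat : ℕ → Set c
  Mat n = Fin n → Fin n → Carrier

  Σᶠ : ∀ {n} → (Fin n → Carrier) → Carrier
  Σᶠ {zero}  f = 0#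
  Σᶠ {suc n} f = f F.zero + Σᶠ (λ i → f (F.suc i))

  _≈ᵛ_ : ∀ {n} → Vec n → Vec n → Set ℓ
  u ≈ᵛ v = ∀ r → u r ≈ v r

  _≈ᴹ_ : ∀ {n} → Mat n → Mat n → Set ℓ
  A ≈ᴹ B = ∀ r s → A r s ≈ B r s

  _-ᵛ_ : ∀ {n} → Vec n → Vec n → Vec n
  (u -ᵛ v) r = u r - v r

  _·_ : ∀ {n} → Mat n → Vec n → Vec n
  (A · v) r = Σᶠ (λ s → A r s * v s)

  _∘ᴹ_ : ∀ {n} → Mat n → Mat n → Mat n
  (A ∘ᴹ B) r s = Σᶠ (λ k → A r k * B k s)

  Id : ∀ {n} → Mat n
  Id r s with r F.≟ s
  ... | yes _ = 1#
  ... | no _ = 0#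

  IsInverse : ∀ {n} → Mat n → Mat n → Set ℓ
  IsInverse A A⁻¹ = ((A ∘ᴹ A⁻¹) ≈ᴹ Id) × ((A⁻¹ ∘ᴹ A) ≈ᴹ Id)

  IsAut : ∀ {n} → Mat n → Set (c ⊔ ℓ)
  IsAut A = ∃ λ A⁻¹ → IsInverse A A⁻¹

  lincomb : ∀ {n} → (Fin n → Carrier) → (Fin n → Vec n) → Vec n
  lincomb a e r = Σᶠ (λ i → a i * e i r)

  IsBasis : ∀ {n} → (Fin n → Vec n) → Set (c ⊔ ℓ)
  IsBasis e = (∀ v → ∃ λ a → v ≈ᵛ lincomb a e)
            × (∀ a → lincomb a e ≈ᵛ (λ _ → 0#) → ∀ i → a i ≈ 0#)

  InSpanFirst : ∀ {n} → (Fin n → Vec n) → ℕ → Vec n → Set (c ⊔ ℓ)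
  InSpanFirst e m v =
    ∃ λ a → (∀ i → m ≤ toℕ i → a i ≈ 0#) × (v ≈ᵛ lincomb a e)

  -- A decorated flag is given by an ordered basis e (indices 0..n-1 here).
  -- Subcyclic: τ e_j - e_{j+1} ∈ ⟨e_0,…,e_j⟩ for all j with j+1 < n.
  Subcyclic : ∀ {n : ℕ} → Mat n → (Fin n → Vec n) → Set (c ⊔ ℓ)
  Subcyclic {n} τ e = ∀ (j k : Fin n) → toℕ k ≡ suc (toℕ j) →
                  InSpanFirst e (suc (toℕ j)) ((τ · e j) -ᵛ e k)

  -- h ∈ N_F : h is an automorphism sending the basis e to a basis giving
  -- the same decorated flag: h e_j - e_j ∈ ⟨e_0,…,e_{j-1}⟩.
  InStab : ∀ {n} → (Fin n → Vec n) → Mat n → Set (c ⊔ ℓ)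
  InStab e h = IsAut h × (∀ j → InSpanFirst e (toℕ j) ((h · e j) -ᵛ e j))

  InCentralizer : ∀ {n} → Mat n → Mat n → Set (c ⊔ ℓ)
  InCentralizer τ c' = IsAut c' × ((c' ∘ᴹ τ) ≈ᴹ (τ ∘ᴹ c'))

  InNG : ∀ {n} → (Fin n → Vec n) → Mat n → Mat n → Set (c ⊔ ℓ)
  InNG e τ g = ∃ λ h → ∃ λ c' → InStab e h × InCentralizer τ c' × (g ≈ᴹ (h ∘ᴹ c'))

{-# OPTIONS --safe #-}
-- Write Fⱼ = ⟨e₀,…,eⱼ₋₁⟩. Subcyclicity says τ eⱼ ≡ eⱼ₊₁ modulo Fⱼ₊₁, so by induction
-- τʲ e₀ ≡ eⱼ modulo Fⱼ. Hence the Krylov vectors τʲ e₀ span V: e₀ is a cyclic vector of τ,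
-- and likewise of σ = gτg⁻¹, so w = g⁻¹ e₀ is τ-cyclic too. Two cyclic vectors of τ differ by
-- an invertible polynomial in τ: c w = e₀ with c, c⁻¹ ∈ R[τ], so c ∈ G_τ. Now h = g c⁻¹ fixes
-- e₀ and intertwines τ with σ, so h (τʲ e₀) = σʲ e₀; comparing both sides with eⱼ modulo Fⱼ
-- gives, by induction on j, h eⱼ - eⱼ ∈ Fⱼ, i.e. h ∈ N_F; and g = h c.
module Submission where

open import Level using (Level; _⊔_)
open import Data.Nat using (ℕ; zero; suc; _≤_; _<_; s≤s)
open import Data.Nat.Properties
  using (≤-trans; <⇒≤; ≮⇒≥; _<?_; <-≤-trans; <⇒≢; m<n⇒m<1+n)
open import Data.Fin as Fin using (Fin; toℕ; fromℕ<; inject₁)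
open import Data.Fin.Properties using (toℕ-fromℕ<; toℕ-inject₁; toℕ<n)
open import Data.Fin.Induction using (<-wellFounded; <-weakInduction)
open import Induction.WellFounded using (module All)
open import Data.Product using (Σ; ∃; _×_; _,_; proj₁; proj₂)
open import Function using (_∘_)
open import Algebra.Bundles using (AbelianGroup; CommutativeRing)
import Algebra.Construct.Pointwise as Pointwise
import Algebra.Properties.AbelianGroup as AbelianGroupProperties
import Algebra.Properties.CommutativeSemigroup as CommutativeSemigroupProperties
import Algebra.Properties.Ring as RingProperties
import Algebra.Properties.Semiring.Sum as SemiringSum
open import Relation.Nullary using (yes; no; contradiction)
open import Relation.Binary.PropositionalEquality as ≡ using (_≡_; _≢_)
import Relation.Binary.Reasoning.Setoid as SetoidReasoning
open import Defs

module DifferenceIdentities {a ℓ} (G : AbelianGroup a ℓ) where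
  open AbelianGroup G
  open AbelianGroupProperties G public using (//-rightDividesˡ)
  open AbelianGroupProperties G using (\\-leftDividesʳ; ⁻¹-anti-homo‿-; xyx⁻¹≈y)
  open SetoidReasoning setoid

  [x-y]∙[y-z]≈x-z : ∀ x y z → (x - y) ∙ (y - z) ≈ x - z
  [x-y]∙[y-z]≈x-z x y z = begin
    (x - y) ∙ (y - z)      ≈⟨ assoc x (y ⁻¹) (y - z) ⟩
    x ∙ (y ⁻¹ ∙ (y - z))   ≈⟨ ∙-congˡ (\\-leftDividesʳ y (z ⁻¹)) ⟩
    x - z                  ∎

  x-[x-y]≈y : ∀ x y → x - (x - y) ≈ y
  x-[x-y]≈y x y = begin
    x - (x - y)  ≈⟨ ∙-congˡ (⁻¹-anti-homo‿- x y) ⟩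
    x ∙ (y - x)  ≈⟨ assoc x y (x ⁻¹) ⟨
    x ∙ y - x    ≈⟨ xyx⁻¹≈y x y ⟩
    y            ∎

  [x-z]-[x-y]≈y-z : ∀ x y z → (x - z) - (x - y) ≈ y - z
  [x-z]-[x-y]≈y-z x y z = begin
    (x - z) - (x - y)  ≈⟨ ∙-congˡ (⁻¹-anti-homo‿- x y) ⟩
    (x - z) ∙ (y - x)  ≈⟨ comm (x - z) (y - x) ⟩
    (y - x) ∙ (x - z)  ≈⟨ [x-y]∙[y-z]≈x-z y x z ⟩
    y - z              ∎

module LinearAlgebra {c ℓ} (R : CommutativeRing c ℓ) where
  open CommutativeRing R
  open Lin R
  open RingProperties ring using (-1*x≈-x)
  open CommutativeSemigroupProperties *-commutativeSemigroup using (x∙yz≈y∙xz)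
  open SemiringSum semiring
    using (sum; sum-cong-≋; sum-replicate-zero; ∑-distrib-+; *-distribˡ-sum; *-distribʳ-sum)

  private variable
    m n : ℕ
    p : Level

  Σᶠ≡sum : (f : Fin n → Carrier) → Σᶠ f ≡ sum f
  Σᶠ≡sum {zero}  f = ≡.refl
  Σᶠ≡sum {suc n} f = ≡.cong (f Fin.zero +_) (Σᶠ≡sum (f ∘ Fin.suc))

  Σᶠ-cong : {f g : Fin n → Carrier} → (∀ i → f i ≈ g i) → Σᶠ f ≈ Σᶠ g
  Σᶠ-cong {f = f} {g} f≈g rewrite Σᶠ≡sum f | Σᶠ≡sum g = sum-cong-≋ f≈g

  Σᶠ-zero : {f : Fin n → Carrier} → (∀ i → f i ≈ 0#) → Σᶠ f ≈ 0#
  Σᶠ-zero {n} f≈0 =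
    trans (Σᶠ-cong f≈0) (trans (reflexive (Σᶠ≡sum {n} (λ _ → 0#))) (sum-replicate-zero n))

  Σᶠ-distrib-+ : (f g : Fin n → Carrier) → Σᶠ (λ i → f i + g i) ≈ Σᶠ f + Σᶠ g
  Σᶠ-distrib-+ f g rewrite Σᶠ≡sum f | Σᶠ≡sum g | Σᶠ≡sum (λ i → f i + g i) = ∑-distrib-+ f g

  *-distribˡ-Σᶠ : ∀ x (f : Fin n → Carrier) → x * Σᶠ f ≈ Σᶠ (λ i → x * f i)
  *-distribˡ-Σᶠ x f rewrite Σᶠ≡sum f | Σᶠ≡sum (λ i → x * f i) = *-distribˡ-sum x f

  *-distribʳ-Σᶠ : ∀ x (f : Fin n → Carrier) → Σᶠ f * x ≈ Σᶠ (λ i → f i * x)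
  *-distribʳ-Σᶠ x f rewrite Σᶠ≡sum f | Σᶠ≡sum (λ i → f i * x) = *-distribʳ-sum x f

  Σᶠ-comm : (f : Fin m → Fin n → Carrier) →
            Σᶠ (λ i → Σᶠ (f i)) ≈ Σᶠ (λ j → Σᶠ (λ i → f i j))
  Σᶠ-comm {zero}  {n} f = sym (Σᶠ-zero {n} (λ _ → refl))
  Σᶠ-comm {suc m}     f = trans (+-congˡ (Σᶠ-comm (f ∘ Fin.suc)))
                                (sym (Σᶠ-distrib-+ (f Fin.zero) _))

  Id-suc : (r s : Fin n) → Id (Fin.suc r) (Fin.suc s) ≡ Id r s
  Id-suc r s with r Fin.≟ s
  ... | yes _ = ≡.refl
  ... | no  _ = ≡.refl

  Id-sym : (r s : Fin n) → Id r s ≡ Id s r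
  Id-sym r s with r Fin.≟ s | s Fin.≟ r
  ... | yes _   | yes _   = ≡.refl
  ... | no  _   | no  _   = ≡.refl
  ... | yes r≡s | no  s≢r = contradiction (≡.sym r≡s) s≢r
  ... | no  r≢s | yes s≡r = contradiction (≡.sym s≡r) r≢s

  Id-off-diagonal : {r s : Fin n} → r ≢ s → Id r s ≡ 0#
  Id-off-diagonal {r = r} {s} r≢s with r Fin.≟ s
  ... | yes r≡s = contradiction r≡s r≢s
  ... | no  _   = ≡.refl

  Σᶠ-Id : (r : Fin n) (f : Fin n → Carrier) → Σᶠ (λ s → Id r s * f s) ≈ f r
  Σᶠ-Id Fin.zero f = begin
    1# * f Fin.zero + Σᶠ (λ s → 0# * f (Fin.suc s))
      ≈⟨ +-cong (*-identityˡ _) (Σᶠ-zero (λ s → zeroˡ (f (Fin.suc s)))) ⟩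
    f Fin.zero + 0#  ≈⟨ +-identityʳ _ ⟩
    f Fin.zero       ∎
    where open SetoidReasoning setoid
  Σᶠ-Id (Fin.suc r) f = begin
    0# * f Fin.zero + Σᶠ (λ s → Id (Fin.suc r) (Fin.suc s) * f (Fin.suc s))
      ≈⟨ +-cong (zeroˡ _) (Σᶠ-cong (λ s → *-congʳ (reflexive (Id-suc r s)))) ⟩
    0# + Σᶠ (λ s → Id r s * f (Fin.suc s))  ≈⟨ +-identityˡ _ ⟩
    Σᶠ (λ s → Id r s * f (Fin.suc s))       ≈⟨ Σᶠ-Id r (f ∘ Fin.suc) ⟩
    f (Fin.suc r)                           ∎
    where open SetoidReasoning setoid

  -- The pointwise ring on Fin n → Carrier; its _≈_ and _-_ are definitionally _≈ᵛ_ and _-ᵛ_.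
  module Rⁿ {n : ℕ} = CommutativeRing (Pointwise.commutativeRing (Fin n) R)
  module ≈ᵛ-Reasoning {n : ℕ} = SetoidReasoning (Rⁿ.setoid {n})
  open module Rⁿ-differences {n : ℕ} = DifferenceIdentities (Rⁿ.+-abelianGroup {n})
  open Rⁿ using () renaming (_+_ to _+ᵛ_; 0# to 0ᵛ)

  infixl 7 _*ᵛ_
  _*ᵛ_ : Carrier → Vec n → Vec n
  (a *ᵛ v) r = a * v r

  Σᵛ : (Fin m → Vec n) → Vec n
  Σᵛ w r = Σᶠ (λ i → w i r)

  u-v≈u+[-1]v : (u v : Vec n) → (u -ᵛ v) ≈ᵛ (u +ᵛ (- 1#) *ᵛ v)
  u-v≈u+[-1]v u v r = +-congˡ (sym (-1*x≈-x (v r)))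

  lincomb-Idˡ : (e : Fin n → Vec n) (i : Fin n) → lincomb (Id i) e ≈ᵛ e i
  lincomb-Idˡ e i r = Σᶠ-Id i (λ k → e k r)

  lincomb-Idʳ : (v : Vec n) → lincomb v Id ≈ᵛ v
  lincomb-Idʳ v r = trans (Σᶠ-cong (λ s → trans (*-comm (v s) (Id s r))
                                                (*-congʳ (reflexive (Id-sym s r)))))
                          (Σᶠ-Id r v)

  record IsLinear (f : Vec n → Vec n) : Set (c ⊔ ℓ) where
    field
      cong   : ∀ {u v} → u ≈ᵛ v → f u ≈ᵛ f v
      +-homo : ∀ u v → f (u +ᵛ v) ≈ᵛ (f u +ᵛ f v)
      *-homo : ∀ a v → f (a *ᵛ v) ≈ᵛ (a *ᵛ f v)

    0-homo : f 0ᵛ ≈ᵛ 0ᵛ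
    0-homo r = trans (cong (λ _ → sym (zeroˡ 0#)) r) (trans (*-homo 0# 0ᵛ r) (zeroˡ _))

    -‿homo : ∀ u v → f (u -ᵛ v) ≈ᵛ (f u -ᵛ f v)
    -‿homo u v r = trans (cong (u-v≈u+[-1]v u v) r)
      (trans (+-homo u _ r) (+-congˡ (trans (*-homo (- 1#) v r) (-1*x≈-x _))))

    Σᵛ-homo : (w : Fin m → Vec n) → f (Σᵛ w) ≈ᵛ Σᵛ (f ∘ w)
    Σᵛ-homo {zero}  w   = 0-homo
    Σᵛ-homo {suc m} w r = trans (+-homo (w Fin.zero) (Σᵛ (w ∘ Fin.suc)) r)
                                (+-congˡ (Σᵛ-homo (w ∘ Fin.suc) r))

    lincomb-homo : ∀ a e → f (lincomb a e) ≈ᵛ lincomb a (f ∘ e)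
    lincomb-homo a e r = trans (Σᵛ-homo (λ i → a i *ᵛ e i) r)
                               (Σᶠ-cong (λ i → *-homo (a i) (e i) r))

  open IsLinear public

  id-isLinear : IsLinear {n} (λ v → v)
  id-isLinear = record { cong = λ u≈v → u≈v ; +-homo = λ _ _ → Rⁿ.refl ; *-homo = λ _ _ → Rⁿ.refl }

  ∘-isLinear : {f g : Vec n → Vec n} → IsLinear f → IsLinear g → IsLinear (f ∘ g)
  ∘-isLinear F G = record
    { cong   = λ u≈v → cong F (cong G u≈v)
    ; +-homo = λ u v → Rⁿ.trans (cong F (+-homo G u v)) (+-homo F _ _)
    ; *-homo = λ a v → Rⁿ.trans (cong F (*-homo G a v)) (*-homo F a _)
    }

  ·-isLinear : (A : Mat n) → IsLinear (A ·_)
  ·-isLinear A = record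
    { cong   = λ u≈v r → Σᶠ-cong (λ s → *-congˡ (u≈v s))
    ; +-homo = λ u v r → trans (Σᶠ-cong (λ s → distribˡ (A r s) (u s) (v s)))
                               (Σᶠ-distrib-+ (λ s → A r s * u s) (λ s → A r s * v s))
    ; *-homo = λ a v r → trans (Σᶠ-cong (λ s → x∙yz≈y∙xz (A r s) a (v s)))
                               (sym (*-distribˡ-Σᶠ a (λ s → A r s * v s)))
    }

  lincomb-isLinear : (e : Fin n → Vec n) → IsLinear (λ a → lincomb a e)
  lincomb-isLinear e = record
    { cong   = λ a≈b r → Σᶠ-cong (λ i → *-congʳ (a≈b i))
    ; +-homo = λ a b r → trans (Σᶠ-cong (λ i → distribʳ (e i r) (a i) (b i)))
                               (Σᶠ-distrib-+ (λ i → a i * e i r) (λ i → b i * e i r))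
    ; *-homo = λ k a r → trans (Σᶠ-cong (λ i → *-assoc k (a i) (e i r)))
                               (sym (*-distribˡ-Σᶠ k (λ i → a i * e i r)))
    }

  record IsSubspace (P : Vec n → Set p) : Set (c ⊔ ℓ ⊔ p) where
    field
      resp     : ∀ {u v} → u ≈ᵛ v → P u → P v
      0∈       : P 0ᵛ
      +-closed : ∀ {u v} → P u → P v → P (u +ᵛ v)
      *-closed : ∀ a {v} → P v → P (a *ᵛ v)

    -‿closed : ∀ {u v} → P u → P v → P (u -ᵛ v)
    -‿closed {u} {v} Pu Pv =
      resp (Rⁿ.sym (u-v≈u+[-1]v u v)) (+-closed Pu (*-closed (- 1#) Pv))

    ∈-from-difference : ∀ {u v} → P (u -ᵛ v) → P v → P u
    ∈-from-difference {u} {v} Pu-v Pv = resp (//-rightDividesˡ v u) (+-closed Pu-v Pv)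

    Σᵛ-closed : ∀ {m} {w : Fin m → Vec n} → (∀ i → P (w i)) → P (Σᵛ w)
    Σᵛ-closed {zero}  _  = 0∈
    Σᵛ-closed {suc m} Pw = +-closed (Pw Fin.zero) (Σᵛ-closed (Pw ∘ Fin.suc))

  open IsSubspace public

  preimage-isSubspace : {f : Vec n → Vec n} {P : Vec n → Set p} →
                        IsLinear f → IsSubspace P → IsSubspace (P ∘ f)
  preimage-isSubspace F P = record
    { resp     = λ u≈v → resp P (cong F u≈v)
    ; 0∈       = resp P (Rⁿ.sym (0-homo F)) (0∈ P)
    ; +-closed = λ Pfu Pfv → resp P (Rⁿ.sym (+-homo F _ _)) (+-closed P Pfu Pfv)
    ; *-closed = λ a Pfv → resp P (Rⁿ.sym (*-homo F a _)) (*-closed P a Pfv)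
    }

  equalizer-isSubspace : {f g : Vec n → Vec n} → IsLinear f → IsLinear g →
                         IsSubspace (λ v → f v ≈ᵛ g v)
  equalizer-isSubspace F G = record
    { resp     = λ u≈v fu≈gu → Rⁿ.trans (Rⁿ.sym (cong F u≈v)) (Rⁿ.trans fu≈gu (cong G u≈v))
    ; 0∈       = Rⁿ.trans (0-homo F) (Rⁿ.sym (0-homo G))
    ; +-closed = λ fu≈gu fv≈gv → Rⁿ.trans (+-homo F _ _)
                   (Rⁿ.trans (Rⁿ.+-cong fu≈gu fv≈gv) (Rⁿ.sym (+-homo G _ _)))
    ; *-closed = λ a fv≈gv → Rⁿ.trans (*-homo F a _)
                   (Rⁿ.trans (λ r → *-congˡ (fv≈gv r)) (Rⁿ.sym (*-homo G a _)))
    }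

  range-isSubspace : {f : Vec n → Vec n} → IsLinear f → IsSubspace (λ v → ∃ λ a → v ≈ᵛ f a)
  range-isSubspace F = record
    { resp     = λ { u≈v (a , u≈fa) → a , Rⁿ.trans (Rⁿ.sym u≈v) u≈fa }
    ; 0∈       = 0ᵛ , Rⁿ.sym (0-homo F)
    ; +-closed = λ { (a , u≈fa) (b , v≈fb) →
                     a +ᵛ b , Rⁿ.trans (Rⁿ.+-cong u≈fa v≈fb) (Rⁿ.sym (+-homo F a b)) }
    ; *-closed = λ { k (a , v≈fa) →
                     k *ᵛ a , Rⁿ.trans (λ r → *-congˡ (v≈fa r)) (Rⁿ.sym (*-homo F k a)) }
    }

  image-isSubspace : {f : Vec n → Vec n} {Q : Vec n → Set p} → IsLinear f → IsSubspace Q →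
                     IsSubspace (λ v → ∃ λ a → Q a × v ≈ᵛ f a)
  image-isSubspace F Q = record
    { resp     = λ { u≈v (a , Qa , u≈fa) → a , Qa , Rⁿ.trans (Rⁿ.sym u≈v) u≈fa }
    ; 0∈       = 0ᵛ , 0∈ Q , Rⁿ.sym (0-homo F)
    ; +-closed = λ { (a , Qa , u≈fa) (b , Qb , v≈fb) →
                     a +ᵛ b , +-closed Q Qa Qb ,
                     Rⁿ.trans (Rⁿ.+-cong u≈fa v≈fb) (Rⁿ.sym (+-homo F a b)) }
    ; *-closed = λ { k (a , Qa , v≈fa) →
                     k *ᵛ a , *-closed Q k Qa ,
                     Rⁿ.trans (λ r → *-congˡ (v≈fa r)) (Rⁿ.sym (*-homo F k a)) }
    }

  Span : (Fin n → Vec n) → Vec n → Set (c ⊔ ℓ)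
  Span e v = ∃ λ a → v ≈ᵛ lincomb a e

  Spans : (Fin n → Vec n) → Set (c ⊔ ℓ)
  Spans e = ∀ v → Span e v

  VanishesFrom : ℕ → Vec n → Set ℓ
  VanishesFrom m a = ∀ i → m ≤ toℕ i → a i ≈ 0#

  Span-isSubspace : (e : Fin n → Vec n) → IsSubspace (Span e)
  Span-isSubspace e = range-isSubspace (lincomb-isLinear e)

  VanishesFrom-isSubspace : ∀ m → IsSubspace {n} (VanishesFrom m)
  VanishesFrom-isSubspace m = record
    { resp     = λ a≈b a↓ i m≤i → trans (sym (a≈b i)) (a↓ i m≤i)
    ; 0∈       = λ _ _ → refl
    ; +-closed = λ a↓ b↓ i m≤i → trans (+-cong (a↓ i m≤i) (b↓ i m≤i)) (+-identityˡ 0#)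
    ; *-closed = λ k a↓ i m≤i → trans (*-congˡ (a↓ i m≤i)) (zeroʳ k)
    }

  InSpanFirst-isSubspace : (e : Fin n → Vec n) (m : ℕ) → IsSubspace (InSpanFirst e m)
  InSpanFirst-isSubspace e m =
    image-isSubspace (lincomb-isLinear e) (VanishesFrom-isSubspace m)

  Span⊆ : {P : Vec n → Set p} {e : Fin n → Vec n} {v : Vec n} →
          IsSubspace P → (∀ i → P (e i)) → Span e v → P v
  Span⊆ P e⊆P (a , v≈ae) =
    resp P (Rⁿ.sym v≈ae) (Σᵛ-closed P (λ i → *-closed P (a i) (e⊆P i)))

  InSpanFirst⊆ : {P : Vec n → Set p} {e : Fin n → Vec n} {v : Vec n} →
                 IsSubspace P → (∀ i → toℕ i < m → P (e i)) → InSpanFirst e m v → P v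
  InSpanFirst⊆ {m = m} {P = P} {e} Pˢ e⊆P (a , a↓ , v≈ae) =
    resp Pˢ (Rⁿ.sym v≈ae) (Σᵛ-closed Pˢ term)
    where
    term : ∀ i → P (a i *ᵛ e i)
    term i with toℕ i <? m
    ... | yes i<m = *-closed Pˢ (a i) (e⊆P i i<m)
    ... | no  i≮m = resp Pˢ (λ r → sym (trans (*-congʳ (a↓ i (≮⇒≥ i≮m))) (zeroˡ _))) (0∈ Pˢ)

  e∈Span : (e : Fin n → Vec n) (i : Fin n) → Span e (e i)
  e∈Span e i = Id i , Rⁿ.sym (lincomb-Idˡ e i)

  e∈InSpanFirst : (e : Fin n → Vec n) {i : Fin n} → toℕ i < m → InSpanFirst e m (e i)
  e∈InSpanFirst e {i} i<m = Id i , Id↓ , Rⁿ.sym (lincomb-Idˡ e i)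
    where
    Id↓ : VanishesFrom _ (Id i)
    Id↓ k m≤k = reflexive (Id-off-diagonal λ i≡k → <⇒≢ (<-≤-trans i<m m≤k) (≡.cong toℕ i≡k))

  InSpanFirst-mono : {e : Fin n → Vec n} {m₁ m₂ : ℕ} {v : Vec n} →
                     m₁ ≤ m₂ → InSpanFirst e m₁ v → InSpanFirst e m₂ v
  InSpanFirst-mono m₁≤m₂ (a , a↓ , v≈ae) = a , (λ i m₂≤i → a↓ i (≤-trans m₁≤m₂ m₂≤i)) , v≈ae

  linear-ext : {f g : Vec n → Vec n} {e : Fin n → Vec n} {v : Vec n} →
               IsLinear f → IsLinear g → (∀ i → f (e i) ≈ᵛ g (e i)) → Span e v → f v ≈ᵛ g v
  linear-ext F G = Span⊆ (equalizer-isSubspace F G)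

  Id-· : (v : Vec n) → (Id · v) ≈ᵛ v
  Id-· v r = Σᶠ-Id r v

  ·-Id-column : (A : Mat n) (s : Fin n) → (A · Id s) ≈ᵛ (λ r → A r s)
  ·-Id-column A s r = trans (Σᶠ-cong (λ k → *-comm (A r k) (Id s k))) (Σᶠ-Id s (A r))

  ·-∘ᴹ : (A B : Mat n) (v : Vec n) → ((A ∘ᴹ B) · v) ≈ᵛ (A · (B · v))
  ·-∘ᴹ A B v r = begin
    Σᶠ (λ s → Σᶠ (λ k → A r k * B k s) * v s)
      ≈⟨ Σᶠ-cong (λ s → *-distribʳ-Σᶠ (v s) (λ k → A r k * B k s)) ⟩
    Σᶠ (λ s → Σᶠ (λ k → A r k * B k s * v s))
      ≈⟨ Σᶠ-comm (λ s k → A r k * B k s * v s) ⟩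
    Σᶠ (λ k → Σᶠ (λ s → A r k * B k s * v s))
      ≈⟨ Σᶠ-cong (λ k → Σᶠ-cong (λ s → *-assoc (A r k) (B k s) (v s))) ⟩
    Σᶠ (λ k → Σᶠ (λ s → A r k * (B k s * v s)))
      ≈⟨ Σᶠ-cong (λ k → *-distribˡ-Σᶠ (A r k) (λ s → B k s * v s)) ⟨
    Σᶠ (λ k → A r k * Σᶠ (λ s → B k s * v s))
      ∎
    where open SetoidReasoning setoid

  ≈ᴹ⇒·≈ : {A B : Mat n} → A ≈ᴹ B → ∀ v → (A · v) ≈ᵛ (B · v)
  ≈ᴹ⇒·≈ A≈B v r = Σᶠ-cong (λ s → *-congʳ (A≈B r s))

  ·≈⇒≈ᴹ : {A B : Mat n} → (∀ v → (A · v) ≈ᵛ (B · v)) → A ≈ᴹ B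
  ·≈⇒≈ᴹ {A = A} {B} A·≈B· r s =
    trans (sym (·-Id-column A s r)) (trans (A·≈B· (Id s) r) (·-Id-column B s r))

  matrix : (Vec n → Vec n) → Mat n
  matrix f r s = f (Id s) r

  matrix-· : {f : Vec n → Vec n} → IsLinear f → ∀ v → (matrix f · v) ≈ᵛ f v
  matrix-· {f = f} F v r = begin
    Σᶠ (λ s → f (Id s) r * v s)  ≈⟨ Σᶠ-cong (λ s → *-comm (f (Id s) r) (v s)) ⟩
    lincomb v (f ∘ Id) r         ≈⟨ lincomb-homo F v Id r ⟨
    f (lincomb v Id) r           ≈⟨ cong F (lincomb-Idʳ v) r ⟩
    f v r                        ∎
    where open SetoidReasoning setoid

  matrix-∘ᴹ : {f g : Vec n → Vec n} → IsLinear f → IsLinear g →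
              ∀ v → ((matrix f ∘ᴹ matrix g) · v) ≈ᵛ f (g v)
  matrix-∘ᴹ {f = f} {g} F G v = begin
    (matrix f ∘ᴹ matrix g) · v    ≈⟨ ·-∘ᴹ (matrix f) (matrix g) v ⟩
    matrix f · (matrix g · v)     ≈⟨ matrix-· F (matrix g · v) ⟩
    f (matrix g · v)              ≈⟨ cong F (matrix-· G v) ⟩
    f (g v)                       ∎
    where open ≈ᵛ-Reasoning

  record Automorphism (n : ℕ) : Set (c ⊔ ℓ) where
    field
      to            : Vec n → Vec n
      from          : Vec n → Vec n
      to-isLinear   : IsLinear to
      from-isLinear : IsLinear from
      inverseˡ      : ∀ v → to (from v) ≈ᵛ v
      inverseʳ      : ∀ v → from (to v) ≈ᵛ v

    matrix-isAut : IsAut (matrix to)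
    matrix-isAut =
      matrix from ,
      ·≈⇒≈ᴹ (λ v → Rⁿ.trans (matrix-∘ᴹ to-isLinear from-isLinear v)
                             (Rⁿ.trans (inverseˡ v) (Rⁿ.sym (Id-· v)))) ,
      ·≈⇒≈ᴹ (λ v → Rⁿ.trans (matrix-∘ᴹ from-isLinear to-isLinear v)
                             (Rⁿ.trans (inverseʳ v) (Rⁿ.sym (Id-· v))))

  open Automorphism public

  ·-automorphism : (A A⁻¹ : Mat n) → IsInverse A A⁻¹ → Automorphism n
  ·-automorphism A A⁻¹ (AA⁻¹≈Id , A⁻¹A≈Id) = record
    { to            = A ·_
    ; from          = A⁻¹ ·_
    ; to-isLinear   = ·-isLinear A
    ; from-isLinear = ·-isLinear A⁻¹
    ; inverseˡ      = λ v → Rⁿ.trans (Rⁿ.sym (·-∘ᴹ A A⁻¹ v)) (Rⁿ.trans (≈ᴹ⇒·≈ AA⁻¹≈Id v) (Id-· v))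
    ; inverseʳ      = λ v → Rⁿ.trans (Rⁿ.sym (·-∘ᴹ A⁻¹ A v)) (Rⁿ.trans (≈ᴹ⇒·≈ A⁻¹A≈Id v) (Id-· v))
    }

  inverse : Automorphism n → Automorphism n
  inverse F = record
    { to            = from F
    ; from          = to F
    ; to-isLinear   = from-isLinear F
    ; from-isLinear = to-isLinear F
    ; inverseˡ      = inverseʳ F
    ; inverseʳ      = inverseˡ F
    }

  _∘ᴬ_ : Automorphism n → Automorphism n → Automorphism n
  F ∘ᴬ G = record
    { to            = to F ∘ to G
    ; from          = from G ∘ from F
    ; to-isLinear   = ∘-isLinear (to-isLinear F) (to-isLinear G)
    ; from-isLinear = ∘-isLinear (from-isLinear G) (from-isLinear F)
    ; inverseˡ      = λ v → Rⁿ.trans (cong (to-isLinear F) (inverseˡ G (from F v))) (inverseˡ F v)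
    ; inverseʳ      = λ v → Rⁿ.trans (cong (from-isLinear G) (inverseʳ F (to G v))) (inverseʳ G v)
    }

  Intertwines : (h f g : Vec n → Vec n) → Set (c ⊔ ℓ)
  Intertwines h f g = ∀ v → h (f v) ≈ᵛ g (h v)

  ∘-intertwines : {h₁ h₂ f g k : Vec n → Vec n} → IsLinear h₁ →
                  Intertwines h₁ g k → Intertwines h₂ f g → Intertwines (h₁ ∘ h₂) f k
  ∘-intertwines H₁ h₁g≈kh₁ h₂f≈gh₂ v = Rⁿ.trans (cong H₁ (h₂f≈gh₂ v)) (h₁g≈kh₁ _)

  conjugate-intertwines : (A A⁻¹ τ : Mat n) → IsInverse A A⁻¹ →
                          Intertwines (A ·_) (τ ·_) (((A ∘ᴹ τ) ∘ᴹ A⁻¹) ·_) ×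
                          Intertwines (A⁻¹ ·_) (((A ∘ᴹ τ) ∘ᴹ A⁻¹) ·_) (τ ·_)
  conjugate-intertwines A A⁻¹ τ A-inverse =
    (λ v → Rⁿ.sym (Rⁿ.trans (σ≈AτA⁻¹ (A · v))
                            (cong (·-isLinear A) (cong (·-isLinear τ) (A⁻¹A≈id v))))) ,
    (λ v → Rⁿ.trans (cong (·-isLinear A⁻¹) (σ≈AτA⁻¹ v)) (A⁻¹A≈id _))
    where
    A⁻¹A≈id = inverseʳ (·-automorphism A A⁻¹ A-inverse)
    σ≈AτA⁻¹ : ∀ v → (((A ∘ᴹ τ) ∘ᴹ A⁻¹) · v) ≈ᵛ (A · (τ · (A⁻¹ · v)))
    σ≈AτA⁻¹ v = Rⁿ.trans (·-∘ᴹ (A ∘ᴹ τ) A⁻¹ v) (·-∘ᴹ A τ (A⁻¹ · v))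

  infixr 8 _^_
  _^_ : (Vec n → Vec n) → ℕ → Vec n → Vec n
  (f ^ zero)  v = v
  (f ^ suc k) v = f ((f ^ k) v)

  ^-isLinear : {f : Vec n → Vec n} → IsLinear f → ∀ k → IsLinear (f ^ k)
  ^-isLinear F zero    = id-isLinear
  ^-isLinear F (suc k) = ∘-isLinear F (^-isLinear F k)

  ^-intertwines : {h f g : Vec n → Vec n} → IsLinear g →
                  Intertwines h f g → ∀ k → Intertwines h (f ^ k) (g ^ k)
  ^-intertwines G hf≈gh zero    v = Rⁿ.refl
  ^-intertwines G hf≈gh (suc k) v = Rⁿ.trans (hf≈gh _) (cong G (^-intertwines G hf≈gh k v))

  krylov : (Vec n → Vec n) → Vec n → Fin n → Vec n
  krylov f u k = (f ^ toℕ k) u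

  Cyclic : (Vec n → Vec n) → Vec n → Set (c ⊔ ℓ)
  Cyclic f u = Spans (krylov f u)

  polynomial : Vec n → (Vec n → Vec n) → Vec n → Vec n
  polynomial a f v = lincomb a (krylov f v)

  polynomial-isLinear : {f : Vec n → Vec n} → IsLinear f → ∀ a → IsLinear (polynomial a f)
  polynomial-isLinear {n} {f} F a = record
    { cong   = λ u≈v r → Σᶠ-cong (λ i → *-congˡ (cong (F^ i) u≈v r))
    ; +-homo = λ u v r →
        trans (Σᶠ-cong (λ i → trans (*-congˡ (+-homo (F^ i) u v r)) (distribˡ _ _ _)))
              (Σᶠ-distrib-+ (λ i → a i * krylov f u i r) (λ i → a i * krylov f v i r))
    ; *-homo = λ b v r →
        trans (Σᶠ-cong (λ i → trans (*-congˡ (*-homo (F^ i) b v r)) (x∙yz≈y∙xz _ _ _)))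
              (sym (*-distribˡ-Σᶠ b (λ i → a i * krylov f v i r)))
    }
    where
    F^ : (i : Fin n) → IsLinear (f ^ toℕ i)
    F^ i = ^-isLinear F (toℕ i)

  polynomial-commutes : {f : Vec n → Vec n} → IsLinear f → ∀ a → Intertwines (polynomial a f) f f
  polynomial-commutes {n} {f} F a v = Rⁿ.trans
    (λ r → Σᶠ-cong λ (i : Fin n) →
       *-congˡ (Rⁿ.sym (^-intertwines {h = f} F (λ _ → Rⁿ.refl) (toℕ i) v) r))
    (Rⁿ.sym (lincomb-homo F a (krylov f v)))

  commutes-fixes-cyclic⇒≈id : {f h : Vec n → Vec n} {u : Vec n} → IsLinear f → IsLinear h →
                              Intertwines h f f → Cyclic f u → h u ≈ᵛ u → ∀ v → h v ≈ᵛ v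
  commutes-fixes-cyclic⇒≈id {f = f} {h} {u} F H hf≈fh u-cyclic hu≈u v =
    linear-ext H id-isLinear h≈id-on-krylov (u-cyclic v)
    where
    h≈id-on-krylov : ∀ k → h (krylov f u k) ≈ᵛ krylov f u k
    h≈id-on-krylov k =
      Rⁿ.trans (^-intertwines F hf≈fh (toℕ k) u) (cong (^-isLinear F (toℕ k)) hu≈u)

  intertwiner-preserves-cyclic : {p f g : Vec n → Vec n} {u : Vec n} →
                                 IsLinear p → IsLinear g → Intertwines p f g →
                                 (∀ v → ∃ λ v′ → p v′ ≈ᵛ v) → Cyclic f u → Cyclic g (p u)
  intertwiner-preserves-cyclic {p = p} {f} {g} {u} P G pf≈gp p-onto u-cyclic v =
    resp Kg (proj₂ (p-onto v)) (Span⊆ (preimage-isSubspace P Kg) p[krylov]∈Kg (u-cyclic _))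
    where
    Kg = Span-isSubspace (krylov g (p u))
    p[krylov]∈Kg : ∀ k → Span (krylov g (p u)) (p (krylov f u k))
    p[krylov]∈Kg k = resp Kg (Rⁿ.sym (^-intertwines G pf≈gp (toℕ k) u)) (e∈Span _ k)

  cyclic-vectors-conjugate : {f : Vec n → Vec n} {u w : Vec n} →
                             IsLinear f → Cyclic f u → Cyclic f w →
                             Σ (Automorphism n) λ C →
                               Intertwines (to C) f f × Intertwines (from C) f f × to C w ≈ᵛ u
  cyclic-vectors-conjugate {f = f} {u} {w} F u-cyclic w-cyclic =
    C , polynomial-commutes F a , polynomial-commutes F b , Rⁿ.sym u≈Cw
    where
    a = proj₁ (w-cyclic u)
    u≈Cw = proj₂ (w-cyclic u)
    b = proj₁ (u-cyclic w)
    w≈Du = proj₂ (u-cyclic w)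
    Cᶠ = polynomial-isLinear F a
    Dᶠ = polynomial-isLinear F b
    C : Automorphism _
    C = record
      { to            = polynomial a f
      ; from          = polynomial b f
      ; to-isLinear   = Cᶠ
      ; from-isLinear = Dᶠ
      ; inverseˡ      = commutes-fixes-cyclic⇒≈id F (∘-isLinear Cᶠ Dᶠ)
          (∘-intertwines {k = f} Cᶠ (polynomial-commutes F a) (polynomial-commutes F b))
          u-cyclic (Rⁿ.trans (cong Cᶠ (Rⁿ.sym w≈Du)) (Rⁿ.sym u≈Cw))
      ; inverseʳ      = commutes-fixes-cyclic⇒≈id F (∘-isLinear Dᶠ Cᶠ)
          (∘-intertwines {k = f} Dᶠ (polynomial-commutes F b) (polynomial-commutes F a))
          w-cyclic (Rⁿ.trans (cong Dᶠ (Rⁿ.sym u≈Cw)) (Rⁿ.sym w≈Du))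
      }

  subcyclic-raises-flag : {τ : Mat n} {e : Fin n → Vec n} → Subcyclic τ e →
                          ∀ {j v} → j < n → InSpanFirst e j v → InSpanFirst e (suc j) (τ · v)
  subcyclic-raises-flag {n} {τ} {e} τ-subcyclic {j} j<n =
    InSpanFirst⊆ (preimage-isSubspace (·-isLinear τ) Fⱼ₊₁) τe∈Fⱼ₊₁
    where
    Fⱼ₊₁ = InSpanFirst-isSubspace e (suc j)
    τe∈Fⱼ₊₁ : ∀ i → toℕ i < j → InSpanFirst e (suc j) (τ · e i)
    τe∈Fⱼ₊₁ i i<j = ∈-from-difference Fⱼ₊₁
      (InSpanFirst-mono (s≤s (<⇒≤ i<j)) (τ-subcyclic i i+1 (toℕ-fromℕ< 1+i<n)))
      (e∈InSpanFirst e (≡.subst (_< suc j) (≡.sym (toℕ-fromℕ< 1+i<n)) (s≤s i<j)))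
      where
      1+i<n : suc (toℕ i) < n
      1+i<n = ≤-trans (s≤s i<j) j<n
      i+1 : Fin n
      i+1 = fromℕ< 1+i<n

  subcyclic-krylov : {τ : Mat (suc n)} {e : Fin (suc n) → Vec (suc n)} → Subcyclic τ e →
                     ∀ j → InSpanFirst e (toℕ j) (krylov (τ ·_) (e Fin.zero) j -ᵛ e j)
  subcyclic-krylov {n} {τ} {e} τ-subcyclic = <-weakInduction P base step
    where
    P : Fin (suc n) → Set (c ⊔ ℓ)
    P j = InSpanFirst e (toℕ j) (krylov (τ ·_) (e Fin.zero) j -ᵛ e j)

    base : P Fin.zero
    base = resp F₀ (λ r → sym (-‿inverseʳ (e Fin.zero r))) (0∈ F₀)
      where F₀ = InSpanFirst-isSubspace e 0

    step : ∀ i → P (inject₁ i) → P (Fin.suc i)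
    step i ih = resp Fᵢ₊₁ telescope (+-closed Fᵢ₊₁ τ[x-eᵢ]∈Fᵢ₊₁ τeᵢ-eᵢ₊₁∈Fᵢ₊₁)
      where
      Fᵢ₊₁ = InSpanFirst-isSubspace e (suc (toℕ i))
      x  = ((τ ·_) ^ toℕ i) (e Fin.zero)
      eᵢ = e (inject₁ i)

      τ[x-eᵢ]∈Fᵢ₊₁ : InSpanFirst e (suc (toℕ i)) (τ · (x -ᵛ eᵢ))
      τ[x-eᵢ]∈Fᵢ₊₁ = subcyclic-raises-flag {τ = τ} τ-subcyclic (m<n⇒m<1+n (toℕ<n i))
        (≡.subst (λ t → InSpanFirst e t (((τ ·_) ^ t) (e Fin.zero) -ᵛ eᵢ)) (toℕ-inject₁ i) ih)

      τeᵢ-eᵢ₊₁∈Fᵢ₊₁ : InSpanFirst e (suc (toℕ i)) ((τ · eᵢ) -ᵛ e (Fin.suc i))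
      τeᵢ-eᵢ₊₁∈Fᵢ₊₁ =
        ≡.subst (λ t → InSpanFirst e (suc t) ((τ · eᵢ) -ᵛ e (Fin.suc i))) (toℕ-inject₁ i)
          (τ-subcyclic (inject₁ i) (Fin.suc i) (≡.cong suc (≡.sym (toℕ-inject₁ i))))

      telescope : ((τ · (x -ᵛ eᵢ)) +ᵛ ((τ · eᵢ) -ᵛ e (Fin.suc i))) ≈ᵛ ((τ · x) -ᵛ e (Fin.suc i))
      telescope = Rⁿ.trans (Rⁿ.+-congʳ (-‿homo (·-isLinear τ) x eᵢ))
                           ([x-y]∙[y-z]≈x-z (τ · x) (τ · eᵢ) (e (Fin.suc i)))

  subcyclic⇒cyclic : {τ : Mat (suc n)} {e : Fin (suc n) → Vec (suc n)} →
                     Subcyclic τ e → Spans e → Cyclic (τ ·_) (e Fin.zero)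
  subcyclic⇒cyclic {n} {τ} {e} τ-subcyclic e-spans v = Span⊆ K e∈K (e-spans v)
    where
    k = krylov (τ ·_) (e Fin.zero)
    K = Span-isSubspace k
    e∈K : ∀ j → Span k (e j)
    e∈K = All.wfRec <-wellFounded _ (Span k ∘ e) λ j ih →
      resp K (x-[x-y]≈y (k j) (e j))
        (-‿closed K (e∈Span k j)
          (InSpanFirst⊆ K (λ i i<j → ih i<j) (subcyclic-krylov {τ = τ} τ-subcyclic j)))

  unipotent-preserves-flag : {h : Vec n → Vec n} {e : Fin n → Vec n} {v : Vec n} →
                             IsLinear h →
                             (∀ i → toℕ i < m → InSpanFirst e (toℕ i) (h (e i) -ᵛ e i)) →
                             InSpanFirst e m v → InSpanFirst e m (h v)
  unipotent-preserves-flag {m = m} {e = e} H unipotent =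
    InSpanFirst⊆ (preimage-isSubspace H Fₘ) λ i i<m →
      ∈-from-difference Fₘ (InSpanFirst-mono (<⇒≤ i<m) (unipotent i i<m)) (e∈InSpanFirst e i<m)
    where
    Fₘ = InSpanFirst-isSubspace e m

  intertwiner-stabilises-flag : {τ σ : Mat (suc n)} {e : Fin (suc n) → Vec (suc n)}
                                {h : Vec (suc n) → Vec (suc n)} →
                                Subcyclic τ e → Subcyclic σ e → IsLinear h →
                                Intertwines h (τ ·_) (σ ·_) → h (e Fin.zero) ≈ᵛ e Fin.zero →
                                ∀ j → InSpanFirst e (toℕ j) (h (e j) -ᵛ e j)
  intertwiner-stabilises-flag {n} {τ} {σ} {e} {h} τ-subcyclic σ-subcyclic H hτ≈σh he₀≈e₀ =
    All.wfRec <-wellFounded _ P λ j ih →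
      resp (Fⱼ j) (difference j)
        (-‿closed (Fⱼ j) (subcyclic-krylov {τ = σ} σ-subcyclic j)
          (unipotent-preserves-flag H (λ i i<j → ih i<j) (subcyclic-krylov {τ = τ} τ-subcyclic j)))
    where
    P : Fin (suc n) → Set (c ⊔ ℓ)
    P j = InSpanFirst e (toℕ j) (h (e j) -ᵛ e j)
    Fⱼ = λ (j : Fin (suc n)) → InSpanFirst-isSubspace e (toℕ j)
    kτ = krylov (τ ·_) (e Fin.zero)
    kσ = krylov (σ ·_) (e Fin.zero)

    h-krylov : ∀ j → h (kτ j) ≈ᵛ kσ j
    h-krylov j = Rⁿ.trans (^-intertwines {h = h} (·-isLinear σ) hτ≈σh (toℕ j) (e Fin.zero))
                          (cong (^-isLinear (·-isLinear σ) (toℕ j)) he₀≈e₀)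

    difference : ∀ j → ((kσ j -ᵛ e j) -ᵛ h (kτ j -ᵛ e j)) ≈ᵛ (h (e j) -ᵛ e j)
    difference j = Rⁿ.trans
      (Rⁿ.+-congˡ (Rⁿ.-‿cong (Rⁿ.trans (-‿homo H (kτ j) (e j)) (Rⁿ.+-congʳ (h-krylov j)))))
      ([x-z]-[x-y]≈y-z (kσ j) (h (e j)) (e j))

  InNG-intro : (τ g g⁻¹ : Mat n) (e : Fin n → Vec n) (g-inverse : IsInverse g g⁻¹)
               (C : Automorphism n) →
               let H = ·-automorphism g g⁻¹ g-inverse ∘ᴬ inverse C in
               (∀ j → InSpanFirst e (toℕ j) (to H (e j) -ᵛ e j)) →
               Intertwines (to C) (τ ·_) (τ ·_) → InNG e τ g
  InNG-intro τ g g⁻¹ e g-inverse C H-stabilises C-commutes =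
    matrix (to H) , matrix (to C) ,
    (matrix-isAut H , λ j → resp (InSpanFirst-isSubspace e (toℕ j))
                                  (Rⁿ.+-congʳ (Rⁿ.sym (matrix-· (to-isLinear H) (e j))))
                                  (H-stabilises j)) ,
    (matrix-isAut C , ·≈⇒≈ᴹ λ v → begin
      (matrix (to C) ∘ᴹ τ) · v  ≈⟨ ·-∘ᴹ (matrix (to C)) τ v ⟩
      matrix (to C) · (τ · v)   ≈⟨ matrix-· (to-isLinear C) (τ · v) ⟩
      to C (τ · v)              ≈⟨ C-commutes v ⟩
      τ · to C v                ≈⟨ cong (·-isLinear τ) (matrix-· (to-isLinear C) v) ⟨
      τ · (matrix (to C) · v)   ≈⟨ ·-∘ᴹ τ (matrix (to C)) v ⟨
      (τ ∘ᴹ matrix (to C)) · v  ∎) ,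
    ·≈⇒≈ᴹ λ v → begin
      g · v                                 ≈⟨ cong (·-isLinear g) (inverseʳ C v) ⟨
      to H (to C v)                         ≈⟨ matrix-∘ᴹ (to-isLinear H) (to-isLinear C) v ⟨
      (matrix (to H) ∘ᴹ matrix (to C)) · v  ∎
    where
    open ≈ᵛ-Reasoning
    H = ·-automorphism g g⁻¹ g-inverse ∘ᴬ inverse C

proposition3p4 : ∀ {c ℓ} (R : CommutativeRing c ℓ) (n : ℕ) →
    let open Lin R in
    (τ g g⁻¹ : Mat n) → IsInverse g g⁻¹ →
    (e : Fin n → Vec n) → IsBasis e →
    Subcyclic τ e → Subcyclic ((g ∘ᴹ τ) ∘ᴹ g⁻¹) e →
    InNG e τ g
proposition3p4 R zero τ g g⁻¹ _ e _ _ _ =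
  g , g , ((g , (λ ()) , (λ ())) , (λ ())) , ((g , (λ ()) , (λ ())) , (λ ())) , (λ ())
proposition3p4 R (suc n) τ g g⁻¹ g-inverse e (e-spans , _) τ-subcyclic σ-subcyclic =
  InNG-intro τ g g⁻¹ e g-inverse C H-stabilises C-commutes
  where
  open Lin R
  open LinearAlgebra R
  σ  = (g ∘ᴹ τ) ∘ᴹ g⁻¹
  e₀ = e Fin.zero
  G  = ·-automorphism g g⁻¹ g-inverse
  gτ≈σg     = proj₁ (conjugate-intertwines g g⁻¹ τ g-inverse)
  g⁻¹σ≈τg⁻¹ = proj₂ (conjugate-intertwines g g⁻¹ τ g-inverse)

  g⁻¹e₀-cyclic : Cyclic (τ ·_) (g⁻¹ · e₀)
  g⁻¹e₀-cyclic = intertwiner-preserves-cyclic {f = σ ·_} (·-isLinear g⁻¹) (·-isLinear τ)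
    g⁻¹σ≈τg⁻¹ (λ v → g · v , inverseʳ G v) (subcyclic⇒cyclic {τ = σ} σ-subcyclic e-spans)

  conjugation = cyclic-vectors-conjugate (·-isLinear τ)
                  (subcyclic⇒cyclic {τ = τ} τ-subcyclic e-spans) g⁻¹e₀-cyclic
  C            = proj₁ conjugation
  C-commutes   = proj₁ (proj₂ conjugation)
  C⁻¹-commutes = proj₁ (proj₂ (proj₂ conjugation))
  Cg⁻¹e₀≈e₀    = proj₂ (proj₂ (proj₂ conjugation))
  H            = G ∘ᴬ inverse C

  He₀≈e₀ : to H e₀ ≈ᵛ e₀
  He₀≈e₀ = Rⁿ.trans (cong (·-isLinear g) (Rⁿ.trans (cong (from-isLinear C) (Rⁿ.sym Cg⁻¹e₀≈e₀))
                                                   (inverseʳ C _)))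
                    (inverseˡ G e₀)

  H-stabilises = intertwiner-stabilises-flag {τ = τ} {σ} τ-subcyclic σ-subcyclic (to-isLinear H)
    (∘-intertwines {h₁ = g ·_} {from C} {τ ·_} {τ ·_} {σ ·_} (·-isLinear g) gτ≈σg C⁻¹-commutes)
    He₀≈e₀
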